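{- Let $n\ge1$, $\lambda$ a partition with at most $n$ parts, and set $t=0$. Let $\mathfrak{s}$ be an admissible state of $\mathfrak{S}^\Gamma_{\lambda,0}$ (context) whose associated strict Gelfand–Tsetlin pattern $(p_{ik})$ satisfies $p_{i-1,k-1}>p_{ik}$ for all $2\le i\le k\le n$. Put $q_{ik}=p_{ik}-(n-k+1)$; then $(q_{ik})$ is a Gelfand–Tsetlin pattern with top row $\lambda$. Let $T$ be the semistandard Young tableau of shape $\lambda$ with entries in $\{1,\dots,n\}$ such that, for each $r=1,\dots,n$, the boxes of $T$ with entries $\le n+1-r$ form the Young diagram of the partition $(q_{rr},q_{r,r+1},\dots,q_{rn})$. Let $\beta(\mathfrak{s})$ be the product of the vertex weights of $\mathfrak{s}$, and let $w_0\beta(\mathfrak{s})$ be obtained from it by substituting $z_i\mapsto z_{n+1-i}$ for all $i$. Then \[w_0\beta(\mathfrak{s})=\Big(\prod_{i=1}^n z_i^{\,i-1}\Big)(z\mid\alpha)^T,\qquad (z\mid\alpha)^T=\prod_{(r,c)\in\lambda}\big(z_{T(r,c)}+\alpha_{T(r,c)+c-r}\big).\]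
   Context: Grid: $n$ rows numbered $1,\dots,n$ top to bottom, $N=n+\lambda_1$ columns numbered $1,\dots,N$ right to left; vertex $(i,j)$ in row $i$, column $j$; each vertex has left, top, right, bottom edges, shared between neighbours, with boundary edges at the ends of each row and column. A state assigns $\pm$ to every edge with left and bottom boundary edges $+$, right boundary edges $-$, top boundary edge of column $j$ equal to $-$ iff $j=\lambda_k+n-k+1$ for some $k$. With $t=0$ the vertex weight at $(i,j)$ for spins (left, top, right, bottom) is: $(+,+,+,+)$: $1$; $(-,-,-,-)$: $z_i$; $(+,-,+,-)$: $0$; $(-,+,-,+)$: $z_i+\alpha_j$; $(-,+,+,-)$: $z_i$; $(+,-,-,+)$: $1$; and admissible states are those where every vertex has one of these six configurations. The associated pattern of a state is the array whose $i$-th row $(p_{ii}>p_{i,i+1}>\dots>p_{in})$ lists the columns $j$ where the vertical edge directly above vertex $(i,j)$ is $-$; it is a strict Gelfand–Tsetlin pattern (rows interleave: $p_{i-1,k-1}\ge p_{ik}\ge p_{i-1,k}$) with top row $(\lambda_k+n-k+1)_k$. $T(r,c)$ is the entry in row $r$, column $c$ (English convention). -}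

module Defs where

open import Level using (Level)
open import Data.Nat using (ℕ; zero; suc; _+_; _∸_; _≤_; _<_)
open import Data.Bool using (Bool; true; false; if_then_else_)
open import Data.List using (List; []; _∷_)
open import Data.Product using (Σ; _×_; ∃-syntax)
open import Relation.Binary.PropositionalEquality using (_≡_)
open import Algebra.Bundles using (CommutativeRing)

data Spin : Set where
  ⊕ ⊖ : Spin

isMinus : Spin → Bool
isMinus ⊕ = false
isMinus ⊖ = true

-- Rows i = 1..n (top to bottom), columns j = 1..N (right to left),
-- N = n + λ₁.
--  * hor i j  (0 ≤ j ≤ N) : horizontal edge in row i between columns j+1
--    (on the left) and j (on the right).  So vertex (i,j) has
--    left edge  hor i j  and right edge  hor i (j ∸ 1);
--    hor i N is the left boundary edge, hor i 0 the right boundary edge.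
--  * ver i j  (1 ≤ i ≤ n+1) : vertical edge directly above vertex (i,j);
--    vertex (i,j) has top edge ver i j and bottom edge ver (suc i) j;
--    ver 1 j is the top boundary edge, ver (n+1) j the bottom boundary edge.
-- Values outside these ranges are irrelevant.

record State : Set where
  field
    hor : ℕ → ℕ → Spin
    ver : ℕ → ℕ → Spin
open State public

-- the six admissible vertex configurations (left, top, right, bottom)
data Adm : Spin → Spin → Spin → Spin → Set where
  a1 : Adm ⊕ ⊕ ⊕ ⊕
  a2 : Adm ⊖ ⊖ ⊖ ⊖
  b1 : Adm ⊕ ⊖ ⊕ ⊖
  b2 : Adm ⊖ ⊕ ⊖ ⊕
  c1 : Adm ⊖ ⊕ ⊕ ⊖
  c2 : Adm ⊕ ⊖ ⊖ ⊕

numCols : ℕ → (ℕ → ℕ) → ℕ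
numCols n lam = n + lam 1

IsPartition : ℕ → (ℕ → ℕ) → Set
IsPartition n lam = ∀ k → 1 ≤ k → k < n → lam (suc k) ≤ lam k

Admissible : ℕ → (ℕ → ℕ) → State → Set
Admissible n lam s =
    (∀ i j → 1 ≤ i → i ≤ n → 1 ≤ j → j ≤ numCols n lam →
       Adm (hor s i j) (ver s i j) (hor s i (j ∸ 1)) (ver s (suc i) j))
  × (∀ i → 1 ≤ i → i ≤ n → hor s i (numCols n lam) ≡ ⊕)
  × (∀ i → 1 ≤ i → i ≤ n → hor s i 0 ≡ ⊖)
  × (∀ j → 1 ≤ j → j ≤ numCols n lam → ver s (suc n) j ≡ ⊕)
  × (∀ j → 1 ≤ j → j ≤ numCols n lam →
       (ver s 1 j ≡ ⊖ → ∃[ k ] (1 ≤ k × k ≤ n × j ≡ lam k + (n ∸ k) + 1))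
     × ((∃[ k ] (1 ≤ k × k ≤ n × j ≡ lam k + (n ∸ k) + 1)) → ver s 1 j ≡ ⊖))

minusCols : (ℕ → Spin) → ℕ → List ℕ
minusCols f zero = []
minusCols f (suc m) =
  if isMinus (f (suc m)) then suc m ∷ minusCols f m else minusCols f m

-- 0-indexed list access with default 0
nth : List ℕ → ℕ → ℕ
nth []       _       = 0
nth (x ∷ xs) zero    = x
nth (x ∷ xs) (suc k) = nth xs k

-- p i k  (1 ≤ i ≤ k ≤ n): the (k-i+1)-th largest column j with the
-- vertical edge above (i,j) equal to ⊖, i.e. row i is (p_ii > … > p_in).
pat : ℕ → (ℕ → ℕ) → State → ℕ → ℕ → ℕ
pat n lam s i k = nth (minusCols (ver s i) (numCols n lam)) (k ∸ i)

qpat : ℕ → (ℕ → ℕ) → State → ℕ → ℕ → ℕ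
qpat n lam s i k = pat n lam s i k ∸ (n ∸ k + 1)

-- Tableaux: T r c for boxes (r,c) of λ, i.e. 1 ≤ r ≤ n, 1 ≤ c ≤ lam r.

IsSSYT : ℕ → (ℕ → ℕ) → (ℕ → ℕ → ℕ) → Set
IsSSYT n lam T =
    (∀ r c → 1 ≤ r → r ≤ n → 1 ≤ c → c ≤ lam r → 1 ≤ T r c × T r c ≤ n)
  × (∀ r c → 1 ≤ r → r ≤ n → 1 ≤ c → suc c ≤ lam r → T r c ≤ T r (suc c))
  × (∀ r c → 1 ≤ r → suc r ≤ n → 1 ≤ c → c ≤ lam (suc r) → T r c < T (suc r) c)

-- for each r = 1..n the boxes with entries ≤ n+1-r form the Young diagram
-- of the partition (q_rr, q_{r,r+1}, …, q_rn); its a-th row (1 ≤ a ≤ n+1-r)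
-- has length q_{r,r+a-1}.
MatchesPattern : ℕ → (ℕ → ℕ) → State → (ℕ → ℕ → ℕ) → Set
MatchesPattern n lam s T =
  ∀ r → 1 ≤ r → r ≤ n → ∀ a c → 1 ≤ a → a ≤ n → 1 ≤ c →
      ((a ≤ n + 1 ∸ r × c ≤ qpat n lam s r (r + a ∸ 1)) →
         (c ≤ lam a × T a c ≤ n + 1 ∸ r))
    × ((c ≤ lam a × T a c ≤ n + 1 ∸ r) →
         (a ≤ n + 1 ∸ r × c ≤ qpat n lam s r (r + a ∸ 1)))

-- Weights, evaluated in an arbitrary commutative ring (a polynomial
-- identity in z, α holds iff it holds for all values in all commutative
-- rings).

module _ {c ℓ : Level} (R : CommutativeRing c ℓ) where
  open CommutativeRing R renaming (_+_ to _+R_; _*_ to _*R_)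

  prodTo : ℕ → (ℕ → Carrier) → Carrier
  prodTo zero    f = 1#
  prodTo (suc m) f = prodTo m f *R f (suc m)

  pow : Carrier → ℕ → Carrier
  pow x zero    = 1#
  pow x (suc k) = pow x k *R x

  -- vertex weight at t = 0, given z_i and α_j
  vweight : Carrier → Carrier → Spin → Spin → Spin → Spin → Carrier
  vweight z a ⊕ ⊕ ⊕ ⊕ = 1#
  vweight z a ⊖ ⊖ ⊖ ⊖ = z
  vweight z a ⊕ ⊖ ⊕ ⊖ = 0#
  vweight z a ⊖ ⊕ ⊖ ⊕ = z +R a
  vweight z a ⊖ ⊕ ⊕ ⊖ = z
  vweight z a ⊕ ⊖ ⊖ ⊕ = 1#
  vweight z a _ _ _ _ = 0#   -- non-admissible; never used

  beta : ℕ → (ℕ → ℕ) → (ℕ → Carrier) → (ℕ → Carrier) → State → Carrier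
  beta n lam z α s =
    prodTo n λ i → prodTo (numCols n lam) λ j →
      vweight (z i) (α j) (hor s i j) (ver s i j) (hor s i (j ∸ 1)) (ver s (suc i) j)

  w0beta : ℕ → (ℕ → ℕ) → (ℕ → Carrier) → (ℕ → Carrier) → State → Carrier
  w0beta n lam z α s = beta n lam (λ i → z (n + 1 ∸ i)) α s

  factorialMonomial : ℕ → (ℕ → ℕ) → (ℕ → Carrier) → (ℕ → Carrier) → (ℕ → ℕ → ℕ) → Carrier
  factorialMonomial n lam z α T =
    prodTo n λ r → prodTo (lam r) λ c → z (T r c) +R α (T r c + c ∸ r)

  rho : ℕ → (ℕ → Carrier) → Carrier
  rho n z = prodTo n λ i → pow (z i) (i ∸ 1)

-- Write P_i for the list p_ii > … > p_in of columns whose vertical edge above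
-- row i carries ⊖ (P_{n+1} is empty by the bottom boundary).  The proof
-- compares both sides row by row of the lattice.
--
-- 1. Row transfer.  Reading row i from right to left, every admissible vertex
--    conserves ⊖ paths, so |P_i| = |P_{i+1}| + 1.  When P_{i+1} lies strictly
--    below P_i entrywise (the hypothesis p_{i-1,k-1} > p_{ik}) the weight of
--    the row with spectral parameter y is
--      y^{|P_{i+1}|} · ∏_a ∏_{P_{i+1}[a] < j < P_i[a]} (y + α_j).
-- 2. Grouping by values.  In row a of T the boxes with entry ≤ m are the
--    first b_a(m) boxes, where b_a(m) is an entry of the pattern q; so the
--    row of (z | α)^T is ∏_m ∏_{b_a(m-1) < c ≤ b_a(m)} (z_m + α_{m+c-a}).
-- 3. Matching.  Exchanging the products over a and m and reversing
--    m = n+1-i, the block (a, m) of step 2 is an index shift of the block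
--    (i, a) of step 1; the powers of step 1 reassemble into ρ(z).

module Submission where

open import Defs
open import Level using (Level)
open import Data.Nat using (ℕ; zero; suc; _+_; _∸_; _≤_; _<_; _>_; z≤n; s≤s; _≤?_)
import Data.Nat.Properties as ℕₚ
open import Data.List using (List; []; _∷_; length)
open import Data.Bool using (true; false; if_then_else_)
open import Data.Unit using (⊤; tt)
open import Data.Empty using (⊥; ⊥-elim)
open import Data.Product using (_×_; _,_; proj₁; proj₂)
open import Data.Sum using (inj₁; inj₂)
open import Relation.Nullary using (yes; no)
import Relation.Binary.PropositionalEquality as ≡
open ≡ using (_≡_; refl)
open import Algebra.Bundles using (CommutativeRing)

StrictlyBelow : List ℕ → List ℕ → Set
StrictlyBelow _       []      = ⊤
StrictlyBelow []      (_ ∷ _) = ⊥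
StrictlyBelow (x ∷ P) (y ∷ Q) = y < x × StrictlyBelow P Q

strictlyBelow-from-nth : ∀ P Q → length P ≡ suc (length Q) →
  (∀ b → b < length Q → nth Q b < nth P b) → StrictlyBelow P Q
strictlyBelow-from-nth P       []      _  _ = tt
strictlyBelow-from-nth []      (_ ∷ _) () _
strictlyBelow-from-nth (x ∷ P) (q ∷ Q) eq lt =
  lt 0 (s≤s z≤n) , strictlyBelow-from-nth P Q (ℕₚ.suc-injective eq) (λ b b< → lt (suc b) (s≤s b<))

nth-beyond-length : ∀ L b → length L ≤ b → nth L b ≡ 0
nth-beyond-length []      b       _         = refl
nth-beyond-length (x ∷ L) (suc b) (s≤s le) = nth-beyond-length L b le

-- One step of minusCols: minusCols f (suc m) is definitionally
-- consIfMinus (f (suc m)) (suc m) (minusCols f m).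
consIfMinus : Spin → ℕ → List ℕ → List ℕ
consIfMinus x k L = if isMinus x then k ∷ L else L

minusCols-length≤ : ∀ f m → length (minusCols f m) ≤ m
minusCols-length≤ f zero = z≤n
minusCols-length≤ f (suc m) with isMinus (f (suc m))
... | true  = s≤s (minusCols-length≤ f m)
... | false = ℕₚ.m≤n⇒m≤1+n (minusCols-length≤ f m)

minusCols-nth≤ : ∀ f m b → nth (minusCols f m) b ≤ m
minusCols-nth≤ f zero b = z≤n
minusCols-nth≤ f (suc m) b with isMinus (f (suc m))
minusCols-nth≤ f (suc m) zero    | true  = ℕₚ.≤-refl
minusCols-nth≤ f (suc m) (suc b) | true  = ℕₚ.m≤n⇒m≤1+n (minusCols-nth≤ f m b)
minusCols-nth≤ f (suc m) b       | false = ℕₚ.m≤n⇒m≤1+n (minusCols-nth≤ f m b)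

-- Strict decrease forces the b-th entry to be at least (length - b).
minusCols-nth≥ : ∀ f m b → b < length (minusCols f m) →
  length (minusCols f m) ∸ b ≤ nth (minusCols f m) b
minusCols-nth≥ f zero b ()
minusCols-nth≥ f (suc m) b lt with isMinus (f (suc m))
minusCols-nth≥ f (suc m) zero    lt       | true  = s≤s (minusCols-length≤ f m)
minusCols-nth≥ f (suc m) (suc b) (s≤s lt) | true  = minusCols-nth≥ f m b lt
minusCols-nth≥ f (suc m) b       lt       | false = minusCols-nth≥ f m b lt

minusCols-all-plus : ∀ f m → (∀ j → 1 ≤ j → j ≤ m → f j ≡ ⊕) → minusCols f m ≡ []
minusCols-all-plus f zero    _ = refl
minusCols-all-plus f (suc m) plus rewrite plus (suc m) (s≤s z≤n) ℕₚ.≤-refl =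
  minusCols-all-plus f m (λ j j1 jm → plus j j1 (ℕₚ.m≤n⇒m≤1+n jm))

-- The ⊖ top columns right of the horizontal edge at position m, together with
-- column m + 1 when that edge carries ⊖ (a ⊖ path crossing it entered the
-- row at a column > m and has not yet gone down).
withCrossing : Spin → ℕ → List ℕ → List ℕ
withCrossing ⊕ m L = L
withCrossing ⊖ m L = suc m ∷ L

-- Conservation of ⊖ paths at an admissible vertex in column m + 1: if the
-- pending top columns outnumber the bottom ⊖ columns by one on the right of
-- the vertex, then they do so on its left.
conservation : ∀ m {l t r b : Spin} → Adm l t r b → (P Q : List ℕ) →
  length (withCrossing r m P) ≡ suc (length Q) →
  length (withCrossing l (suc m) (consIfMinus t (suc m) P)) ≡ suc (length (consIfMinus b (suc m) Q))
conservation m a1 P Q eq = eq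
conservation m a2 P Q eq = ≡.cong suc eq
conservation m b1 P Q eq = ≡.cong suc eq
conservation m b2 P Q eq = eq
conservation m c1 P Q eq = ≡.cong suc eq
conservation m c2 P Q eq = eq

[n+1∸i]∸1≡n∸i : ∀ n i → (n + 1 ∸ i) ∸ 1 ≡ n ∸ i
[n+1∸i]∸1≡n∸i n i rewrite ℕₚ.+-comm n 1 | ℕₚ.∸-+-assoc (suc n) i 1 | ℕₚ.+-comm i 1 = refl

n+1∸[n∸i]≡1+i : ∀ n i → i ≤ n → n + 1 ∸ (n ∸ i) ≡ suc i
n+1∸[n∸i]≡1+i n i le rewrite ℕₚ.+-comm n 1 =
  ≡.trans (ℕₚ.+-∸-assoc 1 (ℕₚ.m∸n≤m n i)) (≡.cong suc (ℕₚ.m∸[m∸n]≡n le))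

[i+a∸1]∸i≡a∸1 : ∀ i a → 1 ≤ a → (i + a ∸ 1) ∸ i ≡ a ∸ 1
[i+a∸1]∸i≡a∸1 i (suc a) _ rewrite ℕₚ.+-suc i a = ℕₚ.m+n∸m≡n i a

n∸[i+a∸1]≡[n+1∸i]∸a : ∀ n i a → 1 ≤ a → n ∸ (i + a ∸ 1) ≡ (n + 1 ∸ i) ∸ a
n∸[i+a∸1]≡[n+1∸i]∸a n i (suc a) _
  rewrite ℕₚ.+-suc i a | ℕₚ.+-comm n 1 | ℕₚ.∸-+-assoc (suc n) i (suc a) | ℕₚ.+-suc i a = refl

[i+a]∸[1+i]≡a∸1 : ∀ i a → i + a ∸ suc i ≡ a ∸ 1
[i+a]∸[1+i]≡a∸1 zero    a = refl
[i+a]∸[1+i]≡a∸1 (suc i) a = [i+a]∸[1+i]≡a∸1 i a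

n∸[i+a]+1≡[n+1∸i]∸a : ∀ n i a → i + a ≤ n → n ∸ (i + a) + 1 ≡ (n + 1 ∸ i) ∸ a
n∸[i+a]+1≡[n+1∸i]∸a n i a le rewrite ℕₚ.+-comm n 1 | ℕₚ.+-comm (n ∸ (i + a)) 1 | ℕₚ.∸-+-assoc (suc n) i a =
  ≡.sym (ℕₚ.+-∸-assoc 1 le)

M∸[a∸1]≡1+[M∸a] : ∀ M a → 1 ≤ a → a ≤ M → M ∸ (a ∸ 1) ≡ suc (M ∸ a)
M∸[a∸1]≡1+[M∸a] M (suc a) _ le = ℕₚ.+-∸-assoc 1 le

[M∸1]∸[a∸1]≡M∸a : ∀ M a → 1 ≤ a → (M ∸ 1) ∸ (a ∸ 1) ≡ M ∸ a
[M∸1]∸[a∸1]≡M∸a M (suc a) _ = ℕₚ.∸-+-assoc M 1 a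

module Products {c ℓ : Level} (R : CommutativeRing c ℓ) where
  open CommutativeRing R renaming (_+_ to _+R_; _*_ to _*R_; refl to ≈-refl; sym to ≈-sym; trans to ≈-trans)
  open import Relation.Binary.Reasoning.Setoid setoid
  open import Algebra.Properties.CommutativeSemigroup *-commutativeSemigroup using (interchange)

  Π : ℕ → (ℕ → Carrier) → Carrier
  Π = prodTo R

  intervalΠ : (ℕ → Carrier) → ℕ → ℕ → Carrier
  intervalΠ f lo hi = Π (hi ∸ lo) (λ d → f (lo + d))

  Π-cong : ∀ n {f g : ℕ → Carrier} → (∀ i → 1 ≤ i → i ≤ n → f i ≈ g i) → Π n f ≈ Π n g
  Π-cong zero    _  = ≈-refl
  Π-cong (suc n) eq = *-cong (Π-cong n (λ i i1 iN → eq i i1 (ℕₚ.m≤n⇒m≤1+n iN))) (eq (suc n) (s≤s z≤n) ℕₚ.≤-refl)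

  Π-ones : ∀ n {f : ℕ → Carrier} → (∀ i → 1 ≤ i → i ≤ n → f i ≈ 1#) → Π n f ≈ 1#
  Π-ones zero    _   = ≈-refl
  Π-ones (suc n) one = ≈-trans (*-cong (Π-ones n (λ i i1 iN → one i i1 (ℕₚ.m≤n⇒m≤1+n iN))) (one (suc n) (s≤s z≤n) ℕₚ.≤-refl))
                               (*-identityˡ 1#)

  Π-length : ∀ {m n} (f : ℕ → Carrier) → m ≡ n → Π m f ≈ Π n f
  Π-length f refl = ≈-refl

  Π-* : ∀ n (f g : ℕ → Carrier) → Π n (λ i → f i *R g i) ≈ Π n f *R Π n g
  Π-* zero    f g = ≈-sym (*-identityˡ 1#)
  Π-* (suc n) f g = ≈-trans (*-congʳ (Π-* n f g)) (interchange _ _ _ _)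

  Π-split : ∀ x d (f : ℕ → Carrier) → Π (x + d) f ≈ Π x f *R Π d (λ e → f (x + e))
  Π-split x zero f = ≈-trans (Π-length f (ℕₚ.+-identityʳ x)) (≈-sym (*-identityʳ _))
  Π-split x (suc d) f = begin
    Π (x + suc d) f                                   ≈⟨ Π-length f (ℕₚ.+-suc x d) ⟩
    Π (x + d) f *R f (suc (x + d))                    ≈⟨ *-cong (Π-split x d f) (reflexive (≡.cong f (≡.sym (ℕₚ.+-suc x d)))) ⟩
    (Π x f *R Π d (λ e → f (x + e))) *R f (x + suc d) ≈⟨ *-assoc _ _ _ ⟩
    Π x f *R (Π d (λ e → f (x + e)) *R f (x + suc d)) ∎

  Π-front : ∀ n (f : ℕ → Carrier) → Π (suc n) f ≈ f 1 *R Π n (λ a → f (suc a))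
  Π-front zero    f = ≈-trans (*-identityˡ _) (≈-sym (*-identityʳ _))
  Π-front (suc n) f = ≈-trans (*-congʳ (Π-front n f)) (*-assoc _ _ _)

  Π-reverse : ∀ n (f : ℕ → Carrier) → Π n f ≈ Π n (λ i → f (n + 1 ∸ i))
  Π-reverse zero    f = ≈-refl
  Π-reverse (suc n) f = begin
    Π n f *R f (suc n)                      ≈⟨ *-cong (Π-reverse n f) (reflexive (≡.cong f (≡.sym (ℕₚ.+-comm n 1)))) ⟩
    Π n (λ i → f (n + 1 ∸ i)) *R f (n + 1)  ≈⟨ *-comm _ _ ⟩
    f (n + 1) *R Π n (λ i → f (n + 1 ∸ i))  ≈⟨ ≈-sym (Π-front n (λ i → f (suc n + 1 ∸ i))) ⟩
    Π (suc n) (λ i → f (suc n + 1 ∸ i))     ∎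

  Π-swap : ∀ n k (X : ℕ → ℕ → Carrier) → Π n (λ a → Π k (X a)) ≈ Π k (λ m → Π n (λ a → X a m))
  Π-swap zero    k X = ≈-sym (Π-ones k (λ _ _ _ → ≈-refl))
  Π-swap (suc n) k X = ≈-trans (*-congʳ (Π-swap n k X)) (≈-sym (Π-* k _ _))

  intervalΠ-empty : ∀ f k → intervalΠ f k k ≈ 1#
  intervalΠ-empty f k = Π-length _ (ℕₚ.n∸n≡0 k)

  intervalΠ-extend : ∀ f lo hi → lo ≤ hi → intervalΠ f lo (suc hi) ≈ intervalΠ f lo hi *R f (suc hi)
  intervalΠ-extend f lo hi le = ≈-trans (Π-length _ (ℕₚ.+-∸-assoc 1 le))
    (*-congˡ (reflexive (≡.cong f (≡.trans (ℕₚ.+-suc lo _) (≡.cong suc (ℕₚ.m+[n∸m]≡n le))))))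

  intervalΠ-cong : ∀ {f g} lo hi → (∀ j → f j ≈ g j) → intervalΠ f lo hi ≈ intervalΠ g lo hi
  intervalΠ-cong lo hi eq = Π-cong (hi ∸ lo) (λ d _ _ → eq (lo + d))

  intervalΠ-unshift : ∀ f sh lo hi → sh ≤ lo → sh ≤ hi →
    intervalΠ (λ c → f (sh + c)) (lo ∸ sh) (hi ∸ sh) ≈ intervalΠ f lo hi
  intervalΠ-unshift f sh lo hi sh≤lo sh≤hi = begin
    intervalΠ (λ c → f (sh + c)) (lo ∸ sh) (hi ∸ sh)
      ≈⟨ Π-cong ((hi ∸ sh) ∸ (lo ∸ sh)) (λ d _ _ → reflexive (≡.cong f (≡.sym (ℕₚ.+-assoc sh (lo ∸ sh) d)))) ⟩
    Π ((hi ∸ sh) ∸ (lo ∸ sh)) (λ d → f (sh + (lo ∸ sh) + d))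
      ≈⟨ Π-length _ (≡.sym (ℕₚ.[m+n]∸[m+o]≡n∸o sh (hi ∸ sh) (lo ∸ sh))) ⟩
    intervalΠ f (sh + (lo ∸ sh)) (sh + (hi ∸ sh))
      ≡⟨ ≡.cong₂ (intervalΠ f) (ℕₚ.m+[n∸m]≡n sh≤lo) (ℕₚ.m+[n∸m]≡n sh≤hi) ⟩
    intervalΠ f lo hi ∎

  module GroupByValue (F : ℕ → ℕ → Carrier) (t b : ℕ → ℕ) (L n : ℕ)
    (b-zero : b 0 ≡ 0)
    (t-range : ∀ c → 1 ≤ c → c ≤ L → 1 ≤ t c × t c ≤ n)
    (small⇒initial : ∀ m → 1 ≤ m → m ≤ n → ∀ c → 1 ≤ c → c ≤ L → t c ≤ m → c ≤ b m)
    (initial⇒small : ∀ m → 1 ≤ m → m ≤ n → ∀ c → 1 ≤ c → c ≤ b m → c ≤ L × t c ≤ m) where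

    b-mono : ∀ m → suc m ≤ n → b m ≤ b (suc m)
    b-mono zero _ rewrite b-zero = z≤n
    b-mono (suc m) le with b (suc m) in eq
    ... | zero  = z≤n
    ... | suc k =
      let small = initial⇒small (suc m) (s≤s z≤n) (ℕₚ.<⇒≤ le) (suc k) (s≤s z≤n) (ℕₚ.≤-reflexive (≡.sym eq))
      in small⇒initial (suc (suc m)) (s≤s z≤n) le (suc k) (s≤s z≤n) (proj₁ small) (ℕₚ.m≤n⇒m≤1+n (proj₂ small))

    beyond-prefix : ∀ m → m ≤ n → ∀ c → 1 ≤ c → c ≤ L → b m < c → m < t c
    beyond-prefix zero    _  c c≥1 cL _  = proj₁ (t-range c c≥1 cL)
    beyond-prefix (suc m) le c c≥1 cL lt =
      ℕₚ.≰⇒> (λ tle → ℕₚ.<⇒≱ lt (small⇒initial (suc m) (s≤s z≤n) le c c≥1 cL tle))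

    value-in-block : ∀ m → suc m ≤ n → ∀ e → 1 ≤ e → b m + e ≤ b (suc m) → t (b m + e) ≡ suc m
    value-in-block m le e e1 within = ℕₚ.≤-antisym (proj₂ small)
      (beyond-prefix m (ℕₚ.<⇒≤ le) (b m + e) positive (proj₁ small) (ℕₚ.m<m+n (b m) e1))
      where
      positive : 1 ≤ b m + e
      positive = ℕₚ.≤-trans e1 (ℕₚ.m≤n+m e (b m))
      small : b m + e ≤ L × t (b m + e) ≤ suc m
      small = initial⇒small (suc m) (s≤s z≤n) le (b m + e) positive within

    grouped-prefix : ∀ m → m ≤ n → Π (b m) (λ c → F (t c) c) ≈ Π m (λ m' → intervalΠ (F m') (b (m' ∸ 1)) (b m'))
    grouped-prefix zero _ rewrite b-zero = ≈-refl
    grouped-prefix (suc m) le = begin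
      Π (b (suc m)) g                                        ≈⟨ Π-length g (≡.sym (ℕₚ.m+[n∸m]≡n (b-mono m le))) ⟩
      Π (b m + (b (suc m) ∸ b m)) g                          ≈⟨ Π-split (b m) _ g ⟩
      Π (b m) g *R Π (b (suc m) ∸ b m) (λ e → g (b m + e))   ≈⟨ *-cong (grouped-prefix m (ℕₚ.<⇒≤ le)) (Π-cong _ block) ⟩
      Π m (λ m' → intervalΠ (F m') (b (m' ∸ 1)) (b m')) *R intervalΠ (F (suc m)) (b m) (b (suc m)) ∎
      where
      g : ℕ → Carrier
      g c = F (t c) c
      block : ∀ e → 1 ≤ e → e ≤ b (suc m) ∸ b m → g (b m + e) ≈ F (suc m) (b m + e)
      block e e1 eb = reflexive (≡.cong (λ v → F v (b m + e)) (value-in-block m le e e1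
        (ℕₚ.≤-trans (ℕₚ.+-monoʳ-≤ (b m) eb) (ℕₚ.≤-reflexive (ℕₚ.m+[n∸m]≡n (b-mono m le))))))

    -- every box has value ≤ n, so all L boxes are counted by b n
    b-top : 1 ≤ n → b n ≡ L
    b-top n1 = ℕₚ.≤-antisym b≤L (L≤b L ℕₚ.≤-refl)
      where
      b≤L : b n ≤ L
      b≤L with b n in eq
      ... | zero  = z≤n
      ... | suc k = proj₁ (initial⇒small n n1 ℕₚ.≤-refl (suc k) (s≤s z≤n) (ℕₚ.≤-reflexive (≡.sym eq)))
      L≤b : ∀ c → c ≤ L → c ≤ b n
      L≤b zero    _  = z≤n
      L≤b (suc c) le = small⇒initial n n1 ℕₚ.≤-refl (suc c) (s≤s z≤n) le (proj₂ (t-range (suc c) (s≤s z≤n) le))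

    groupByValue : 1 ≤ n → Π L (λ c → F (t c) c) ≈ Π n (λ m → intervalΠ (F m) (b (m ∸ 1)) (b m))
    groupByValue n1 = ≈-trans (Π-length _ (≡.sym (b-top n1))) (grouped-prefix n ℕₚ.≤-refl)

-- The weight of one row of the lattice with spectral parameter y, in terms of
-- the lists P of top and Q of bottom ⊖ columns.  A ⊖ path entering from the
-- top at column p turns right (c2, weight 1), crosses the columns q < j < p
-- (b2, weight y + α_j) and turns down at column q (c1, weight y); the path
-- without a partner in Q leaves through the right boundary.
module RowTransfer {c ℓ : Level} (R : CommutativeRing c ℓ)
  (y : CommutativeRing.Carrier R) (α : ℕ → CommutativeRing.Carrier R) where
  open CommutativeRing R renaming (_+_ to _+R_; _*_ to _*R_; refl to ≈-refl; sym to ≈-sym; trans to ≈-trans)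
  open Products R
  open import Relation.Binary.Reasoning.Setoid setoid
  open import Algebra.Properties.CommutativeSemigroup *-commutativeSemigroup using (interchange; xy∙z≈xz∙y)

  yα : ℕ → Carrier
  yα j = y +R α j

  pathWeight : List ℕ → List ℕ → Carrier
  pathWeight []      _       = 1#
  pathWeight (p ∷ P) []      = intervalΠ yα 0 (p ∸ 1)
  pathWeight (p ∷ P) (q ∷ Q) = intervalΠ yα q (p ∸ 1) *R y *R pathWeight P Q

  -- Transfer through the vertex in column m + 1: multiplying the weight of
  -- the columns 1, …, m by the vertex weight gives the weight of 1, …, m + 1
  -- (the bottom ⊖ columns seen so far lie in 1, …, m).
  transferVertex : ∀ m {l t r b} → Adm l t r b → (P Q : List ℕ) (X : Carrier) → nth Q 0 ≤ m →
    (StrictlyBelow (withCrossing r m P) Q → X ≈ pathWeight (withCrossing r m P) Q) →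
    StrictlyBelow (withCrossing l (suc m) (consIfMinus t (suc m) P)) (consIfMinus b (suc m) Q) →
    X *R vweight R y (α (suc m)) l t r b ≈ pathWeight (withCrossing l (suc m) (consIfMinus t (suc m) P)) (consIfMinus b (suc m) Q)
  transferVertex m a1 P Q X _ ih below = ≈-trans (*-identityʳ X) (ih below)
  transferVertex m a2 P Q X _ ih (_ , below) = begin
    X *R y                                      ≈⟨ *-comm X y ⟩
    y *R X                                      ≈⟨ *-cong (≈-sym (*-identityˡ y)) (ih below) ⟩
    1# *R y *R pathWeight (suc m ∷ P) Q         ≈⟨ *-congʳ (*-congʳ (≈-sym (intervalΠ-empty yα (suc m)))) ⟩
    intervalΠ yα (suc m) (suc m) *R y *R pathWeight (suc m ∷ P) Q ∎
  transferVertex m b1 P Q X _ ih (m<m , _) = ⊥-elim (ℕₚ.<-irrefl refl m<m)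
  transferVertex m b2 P []      X _  ih below = *-congʳ (ih tt)
  transferVertex m b2 P (q ∷ Q) X q≤m ih (_ , below) = begin
    X *R yα (suc m)                                        ≈⟨ *-congʳ (ih (s≤s q≤m , below)) ⟩
    (intervalΠ yα q m *R y *R pathWeight P Q) *R yα (suc m) ≈⟨ xy∙z≈xz∙y _ _ _ ⟩
    (intervalΠ yα q m *R y) *R yα (suc m) *R pathWeight P Q ≈⟨ *-congʳ (xy∙z≈xz∙y _ _ _) ⟩
    (intervalΠ yα q m *R yα (suc m)) *R y *R pathWeight P Q ≈⟨ *-congʳ (*-congʳ (≈-sym (intervalΠ-extend yα q m q≤m))) ⟩
    intervalΠ yα q (suc m) *R y *R pathWeight P Q ∎
  transferVertex m c1 P Q X _ ih (_ , below) = begin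
    X *R y                                      ≈⟨ *-comm X y ⟩
    y *R X                                      ≈⟨ *-cong (≈-sym (*-identityˡ y)) (ih below) ⟩
    1# *R y *R pathWeight P Q                   ≈⟨ *-congʳ (*-congʳ (≈-sym (intervalΠ-empty yα (suc m)))) ⟩
    intervalΠ yα (suc m) (suc m) *R y *R pathWeight P Q ∎
  transferVertex m c2 P Q X _ ih below = ≈-trans (*-identityʳ X) (ih below)

  block : List ℕ → List ℕ → ℕ → Carrier
  block P Q a = intervalΠ yα (nth Q (a ∸ 1)) (nth P (a ∸ 1) ∸ 1)

  -- the turning factors collect into y^{|Q|}; the rest splits into blocks,
  -- padded with empty blocks up to any K ≥ |P|
  pathWeight-blocks : ∀ P Q K → length P ≡ suc (length Q) → length P ≤ K →
    pathWeight P Q ≈ pow R y (length Q) *R Π K (block P Q)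
  pathWeight-blocks (p ∷ []) [] (suc K) _ _ = begin
    intervalΠ yα 0 (p ∸ 1)                   ≈⟨ ≈-sym (*-identityʳ _) ⟩
    intervalΠ yα 0 (p ∸ 1) *R 1#             ≈⟨ *-congˡ (≈-sym (Π-ones K (λ { (suc a) _ _ → ≈-refl }))) ⟩
    block (p ∷ []) [] 1 *R Π K (λ a → block (p ∷ []) [] (suc a)) ≈⟨ ≈-sym (Π-front K _) ⟩
    Π (suc K) (block (p ∷ []) [])           ≈⟨ ≈-sym (*-identityˡ _) ⟩
    1# *R Π (suc K) (block (p ∷ []) [])     ∎
  pathWeight-blocks (p ∷ P) (q ∷ Q) (suc K) eq (s≤s le) = begin
    A *R y *R pathWeight P Q              ≈⟨ *-congˡ (pathWeight-blocks P Q K (ℕₚ.suc-injective eq) le) ⟩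
    (A *R y) *R (yᵏ *R Π K (block P Q))   ≈⟨ *-congʳ (*-comm A y) ⟩
    (y *R A) *R (yᵏ *R Π K (block P Q))   ≈⟨ interchange _ _ _ _ ⟩
    (y *R yᵏ) *R (A *R Π K (block P Q))   ≈⟨ *-cong (*-comm y yᵏ) (*-congˡ (Π-cong K (λ { (suc a) _ _ → ≈-refl }))) ⟩
    (yᵏ *R y) *R (A *R Π K (λ a → block (p ∷ P) (q ∷ Q) (suc a))) ≈⟨ *-congˡ (≈-sym (Π-front K _)) ⟩
    (yᵏ *R y) *R Π (suc K) (block (p ∷ P) (q ∷ Q)) ∎
    where
    A yᵏ : Carrier
    A  = intervalΠ yα q (p ∸ 1)
    yᵏ = pow R y (length Q)

module Lattice (n : ℕ) (lam : ℕ → ℕ) (s : State) (adm : Admissible n lam s) where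

  cols : ℕ
  cols = numCols n lam

  row : ℕ → List ℕ
  row i = minusCols (ver s i) cols

  vertexAdm : ∀ i j → 1 ≤ i → i ≤ n → 1 ≤ j → j ≤ cols →
    Adm (hor s i j) (ver s i j) (hor s i (j ∸ 1)) (ver s (suc i) j)
  vertexAdm = proj₁ adm

  leftBoundary : ∀ i → 1 ≤ i → i ≤ n → hor s i cols ≡ ⊕
  leftBoundary = proj₁ (proj₂ adm)

  rightBoundary : ∀ i → 1 ≤ i → i ≤ n → hor s i 0 ≡ ⊖
  rightBoundary = proj₁ (proj₂ (proj₂ adm))

  bottomBoundary : ∀ j → 1 ≤ j → j ≤ cols → ver s (suc n) j ≡ ⊕
  bottomBoundary = proj₁ (proj₂ (proj₂ (proj₂ adm)))

  crossing-length : ∀ i → 1 ≤ i → i ≤ n → ∀ m → m ≤ cols →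
    length (withCrossing (hor s i m) m (minusCols (ver s i) m)) ≡ suc (length (minusCols (ver s (suc i)) m))
  crossing-length i i≥1 i≤n zero _ rewrite rightBoundary i i≥1 i≤n = refl
  crossing-length i i≥1 i≤n (suc m) le = conservation m (vertexAdm i (suc m) i≥1 i≤n (s≤s z≤n) le) _ _
    (crossing-length i i≥1 i≤n m (ℕₚ.<⇒≤ le))

  row-length-step : ∀ i → 1 ≤ i → i ≤ n → length (row i) ≡ suc (length (row (suc i)))
  row-length-step i i≥1 i≤n = ≡.subst (λ h → length (withCrossing h cols (row i)) ≡ suc (length (row (suc i))))
    (leftBoundary i i≥1 i≤n) (crossing-length i i≥1 i≤n cols ℕₚ.≤-refl)

  bottom-row : row (suc n) ≡ []
  bottom-row = minusCols-all-plus (ver s (suc n)) cols bottomBoundary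

  row-length-from : ∀ d r → 1 ≤ r → r + d ≡ suc n → length (row r) ≡ d
  row-length-from zero r _ eq with ≡.trans (≡.sym (ℕₚ.+-identityʳ r)) eq
  ... | refl = ≡.cong length bottom-row
  row-length-from (suc d) r r≥1 eq = ≡.trans (row-length-step r r≥1 r≤n)
    (≡.cong suc (row-length-from d (suc r) (s≤s z≤n) eq′))
    where
    eq′ : suc r + d ≡ suc n
    eq′ = ≡.trans (≡.sym (ℕₚ.+-suc r d)) eq
    r≤n : r ≤ n
    r≤n = ℕₚ.≤-pred (ℕₚ.≤-trans (ℕₚ.m≤m+n (suc r) d) (ℕₚ.≤-reflexive eq′))

  row-length : ∀ r → 1 ≤ r → r ≤ n + 1 → length (row r) ≡ n + 1 ∸ r
  row-length r r≥1 le = row-length-from (n + 1 ∸ r) r r≥1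
    (≡.trans (ℕₚ.m+[n∸m]≡n le) (ℕₚ.+-comm n 1))

  next-row-length : ∀ i → i ≤ n → length (row (suc i)) ≡ n ∸ i
  next-row-length i i≤n = row-length-from (n ∸ i) (suc i) (s≤s z≤n) (≡.cong suc (ℕₚ.m+[n∸m]≡n i≤n))

  StrictPattern : Set
  StrictPattern = ∀ i k → 2 ≤ i → i ≤ k → k ≤ n → pat n lam s (i ∸ 1) (k ∸ 1) > pat n lam s i k

  row-strictlyBelow : StrictPattern → ∀ i → 1 ≤ i → i ≤ n → StrictlyBelow (row i) (row (suc i))
  row-strictlyBelow strict i i≥1 i≤n = strictlyBelow-from-nth (row i) (row (suc i)) (row-length-step i i≥1 i≤n) below
    where
    below : ∀ b → b < length (row (suc i)) → nth (row (suc i)) b < nth (row i) b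
    below b b< = ≡.subst (λ k → nth (row (suc i)) k < nth (row i) k) (ℕₚ.m+n∸m≡n i b)
      (strict (suc i) (suc i + b) (s≤s i≥1) (ℕₚ.m≤m+n (suc i) b) bound)
      where
      bound : suc i + b ≤ n
      bound = ℕₚ.≤-trans (ℕₚ.+-monoʳ-< i (ℕₚ.<-≤-trans b< (ℕₚ.≤-reflexive (next-row-length i i≤n))))
                (ℕₚ.≤-reflexive (ℕₚ.m+[n∸m]≡n i≤n))

  module RowWeight {c ℓ : Level} (R : CommutativeRing c ℓ) (α : ℕ → CommutativeRing.Carrier R) where
    open CommutativeRing R renaming (_+_ to _+R_; _*_ to _*R_; refl to ≈-refl; sym to ≈-sym; trans to ≈-trans)
    open Products R
    open import Relation.Binary.Reasoning.Setoid setoid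

    rowWeight : ℕ → Carrier → Carrier
    rowWeight i y = Π cols (λ j → vweight R y (α j) (hor s i j) (ver s i j) (hor s i (j ∸ 1)) (ver s (suc i) j))

    module _ (i : ℕ) (i≥1 : 1 ≤ i) (i≤n : i ≤ n) (y : Carrier) where
      open RowTransfer R y α

      -- invariant of the right-to-left scan: the first m vertices of the row
      -- weigh pathWeight of the columns seen so far
      partialWeight : ∀ m → m ≤ cols →
        StrictlyBelow (withCrossing (hor s i m) m (minusCols (ver s i) m)) (minusCols (ver s (suc i)) m) →
        Π m (λ j → vweight R y (α j) (hor s i j) (ver s i j) (hor s i (j ∸ 1)) (ver s (suc i) j))
          ≈ pathWeight (withCrossing (hor s i m) m (minusCols (ver s i) m)) (minusCols (ver s (suc i)) m)
      partialWeight zero _ _ rewrite rightBoundary i i≥1 i≤n = ≈-refl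
      partialWeight (suc m) le = transferVertex m (vertexAdm i (suc m) i≥1 i≤n (s≤s z≤n) le) _ _ _
        (minusCols-nth≤ (ver s (suc i)) m 0) (partialWeight m (ℕₚ.<⇒≤ le))

      rowWeight-pathWeight : StrictlyBelow (row i) (row (suc i)) → rowWeight i y ≈ pathWeight (row i) (row (suc i))
      rowWeight-pathWeight = ≡.subst
        (λ h → StrictlyBelow (withCrossing h cols (row i)) (row (suc i)) →
               rowWeight i y ≈ pathWeight (withCrossing h cols (row i)) (row (suc i)))
        (leftBoundary i i≥1 i≤n) (partialWeight cols ℕₚ.≤-refl)

      rowWeight-blocks : StrictPattern → rowWeight i y ≈ pow R y (n ∸ i) *R Π n (block (row i) (row (suc i)))
      rowWeight-blocks strict = begin
        rowWeight i y                                           ≈⟨ rowWeight-pathWeight (row-strictlyBelow strict i i≥1 i≤n) ⟩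
        pathWeight (row i) (row (suc i))                        ≈⟨ pathWeight-blocks (row i) (row (suc i)) n (row-length-step i i≥1 i≤n) |P|≤n ⟩
        pow R y (length (row (suc i))) *R Π n (block (row i) (row (suc i)))
          ≈⟨ *-congʳ (reflexive (≡.cong (pow R y) (next-row-length i i≤n))) ⟩
        pow R y (n ∸ i) *R Π n (block (row i) (row (suc i)))   ∎
        where
        |P|≤n : length (row i) ≤ n
        |P|≤n = ℕₚ.≤-trans (ℕₚ.≤-reflexive (row-length i i≥1 (ℕₚ.≤-trans i≤n (ℕₚ.m≤m+n n 1))))
                  (ℕₚ.≤-trans (ℕₚ.∸-monoʳ-≤ (n + 1) i≥1) (ℕₚ.≤-reflexive (ℕₚ.m+n∸n≡m n 1)))

-- The thresholds of T read off the pattern.  For a box row a and an entry m,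
-- b_a(m) = q_{r, r+a-1} with r = n + 1 - m is, by MatchesPattern, the number
-- of boxes of row a with entry ≤ m.
module Thresholds (n : ℕ) (lam : ℕ → ℕ) (s : State) (adm : Admissible n lam s) where
  open Lattice n lam s adm
  open ≡.≡-Reasoning

  boxesAtMost : ℕ → ℕ → ℕ
  boxesAtMost a m = qpat n lam s (n + 1 ∸ m) (n + 1 ∸ m + a ∸ 1)

  reflect-≥1 : ∀ m → m ≤ n → 1 ≤ n + 1 ∸ m
  reflect-≥1 m m≤n = ℕₚ.m<n⇒0<n∸m (ℕₚ.≤-trans (s≤s m≤n) (ℕₚ.≤-reflexive (ℕₚ.+-comm 1 n)))

  reflect-≤n : ∀ m → 1 ≤ m → n + 1 ∸ m ≤ n
  reflect-≤n m m≥1 = ℕₚ.≤-trans (ℕₚ.∸-monoʳ-≤ (n + 1) m≥1) (ℕₚ.≤-reflexive (ℕₚ.m+n∸n≡m n 1))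

  reflect-reflect : ∀ m → m ≤ n → n + 1 ∸ (n + 1 ∸ m) ≡ m
  reflect-reflect m m≤n = ℕₚ.m∸[m∸n]≡n (ℕₚ.≤-trans m≤n (ℕₚ.m≤m+n n 1))

  qpat-beyond : ∀ r k → 1 ≤ r → r ≤ n + 1 → n + 1 ∸ r ≤ k ∸ r → qpat n lam s r k ≡ 0
  qpat-beyond r k r≥1 r≤ le
    rewrite nth-beyond-length (row r) (k ∸ r) (ℕₚ.≤-trans (ℕₚ.≤-reflexive (row-length r r≥1 r≤)) le) =
    ℕₚ.0∸n≡0 (n ∸ k + 1)

  boxesAtMost-zero : ∀ a m → m ≤ n → m < a → boxesAtMost a m ≡ 0
  boxesAtMost-zero a m m≤n m<a = qpat-beyond (n + 1 ∸ m) (n + 1 ∸ m + a ∸ 1) (reflect-≥1 m m≤n) (ℕₚ.m∸n≤m (n + 1) m)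
    (ℕₚ.≤-trans (ℕₚ.≤-reflexive (reflect-reflect m m≤n))
      (ℕₚ.≤-trans (ℕₚ.∸-monoˡ-≤ 1 m<a)
        (ℕₚ.≤-reflexive (≡.sym ([i+a∸1]∸i≡a∸1 (n + 1 ∸ m) a (ℕₚ.≤-trans (s≤s z≤n) m<a))))))

  -- Row i of the lattice against the entry m = n + 1 - i of T, for box row a:
  -- with P′ = P_i[a] and Q′ = P_{i+1}[a] the thresholds are P′ - 1 and Q′,
  -- both shifted down by m - a.
  module Reflected (i : ℕ) (i≥1 : 1 ≤ i) (i≤n : i ≤ n) (a : ℕ) (a≥1 : 1 ≤ a) where

    m : ℕ
    m = n + 1 ∸ i

    P′ Q′ : ℕ
    P′ = nth (row i) (a ∸ 1)
    Q′ = nth (row (suc i)) (a ∸ 1)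

    |P|≡m : length (row i) ≡ m
    |P|≡m = row-length i i≥1 (ℕₚ.≤-trans i≤n (ℕₚ.m≤m+n n 1))

    |Q|≡m∸1 : length (row (suc i)) ≡ m ∸ 1
    |Q|≡m∸1 = ≡.cong (_∸ 1) (≡.trans (≡.sym (row-length-step i i≥1 i≤n)) |P|≡m)

    a∸1<a : a ∸ 1 < a
    a∸1<a = ℕₚ.≤-reflexive (≡.sym (ℕₚ.+-∸-assoc 1 a≥1))

    upper-threshold : boxesAtMost a m ≡ (P′ ∸ 1) ∸ (m ∸ a)
    upper-threshold = begin
      boxesAtMost a m
        ≡⟨ ≡.cong (λ r → qpat n lam s r (r + a ∸ 1)) (reflect-reflect i i≤n) ⟩
      nth (row i) ((i + a ∸ 1) ∸ i) ∸ (n ∸ (i + a ∸ 1) + 1)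
        ≡⟨ ≡.cong₂ (λ x o → nth (row i) x ∸ o) ([i+a∸1]∸i≡a∸1 i a a≥1)
                   (≡.trans (≡.cong (_+ 1) (n∸[i+a∸1]≡[n+1∸i]∸a n i a a≥1)) (ℕₚ.+-comm (m ∸ a) 1)) ⟩
      P′ ∸ suc (m ∸ a)
        ≡⟨ ℕₚ.∸-+-assoc P′ 1 (m ∸ a) ⟨
      (P′ ∸ 1) ∸ (m ∸ a) ∎

    -- the shifts are admissible: the entries of P_i, P_{i+1} are large enough
    upper-bound : a ≤ m → suc (m ∸ a) ≤ P′
    upper-bound a≤m = ℕₚ.≤-trans
      (ℕₚ.≤-reflexive (≡.sym (≡.trans (≡.cong (_∸ (a ∸ 1)) |P|≡m) (M∸[a∸1]≡1+[M∸a] m a a≥1 a≤m))))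
      (minusCols-nth≥ (ver s i) cols (a ∸ 1) (ℕₚ.<-≤-trans a∸1<a (ℕₚ.≤-trans a≤m (ℕₚ.≤-reflexive (≡.sym |P|≡m)))))

    -- for a < m the row i + 1 still has an a-th entry
    lower-threshold< : a < m → boxesAtMost a (m ∸ 1) ≡ Q′ ∸ (m ∸ a)
    lower-threshold< a<m = begin
      boxesAtMost a (m ∸ 1)
        ≡⟨ ≡.cong (λ r → qpat n lam s r (r + a ∸ 1)) r≡1+i ⟩
      nth (row (suc i)) ((i + a) ∸ suc i) ∸ (n ∸ (i + a) + 1)
        ≡⟨ ≡.cong₂ (λ x o → nth (row (suc i)) x ∸ o) ([i+a]∸[1+i]≡a∸1 i a) (n∸[i+a]+1≡[n+1∸i]∸a n i a i+a≤n) ⟩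
      Q′ ∸ (m ∸ a) ∎
      where
      r≡1+i : n + 1 ∸ (m ∸ 1) ≡ suc i
      r≡1+i = ≡.trans (≡.cong (n + 1 ∸_) ([n+1∸i]∸1≡n∸i n i)) (n+1∸[n∸i]≡1+i n i i≤n)
      i+a≤n : i + a ≤ n
      i+a≤n = ℕₚ.≤-pred (ℕₚ.≤-trans (ℕₚ.≤-reflexive (≡.sym (ℕₚ.+-suc i a)))
                (ℕₚ.≤-trans (ℕₚ.+-monoʳ-≤ i a<m)
                  (ℕₚ.≤-reflexive (≡.trans (ℕₚ.m+[n∸m]≡n (ℕₚ.≤-trans i≤n (ℕₚ.m≤m+n n 1))) (ℕₚ.+-comm n 1)))))

    lower-bound< : a < m → m ∸ a ≤ Q′
    lower-bound< a<m = ℕₚ.≤-trans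
      (ℕₚ.≤-reflexive (≡.sym (≡.trans (≡.cong (_∸ (a ∸ 1)) |Q|≡m∸1) ([M∸1]∸[a∸1]≡M∸a m a a≥1))))
      (minusCols-nth≥ (ver s (suc i)) cols (a ∸ 1)
        (ℕₚ.<-≤-trans a∸1<a (ℕₚ.≤-trans (ℕₚ.∸-monoˡ-≤ 1 a<m) (ℕₚ.≤-reflexive (≡.sym |Q|≡m∸1)))))

    -- P_{i+1} has only m - 1 entries
    Q′-beyond : m ≤ a → Q′ ≡ 0
    Q′-beyond m≤a = nth-beyond-length (row (suc i)) (a ∸ 1)
      (ℕₚ.≤-trans (ℕₚ.≤-reflexive |Q|≡m∸1) (ℕₚ.∸-monoˡ-≤ 1 m≤a))

    -- b_a(m - 1) = Q′ - (m - a); for a = m both sides vanish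
    lower-threshold : a ≤ m → boxesAtMost a (m ∸ 1) ≡ Q′ ∸ (m ∸ a) × m ∸ a ≤ Q′
    lower-threshold a≤m with ℕₚ.m≤n⇒m<n∨m≡n a≤m
    ... | inj₁ a<m  = lower-threshold< a<m , lower-bound< a<m
    ... | inj₂ refl rewrite ℕₚ.n∸n≡0 a | Q′-beyond ℕₚ.≤-refl =
      boxesAtMost-zero a (a ∸ 1) (ℕₚ.≤-trans (ℕₚ.m∸n≤m a 1) (reflect-≤n i i≥1)) a∸1<a , z≤n

    beyond : m < a → boxesAtMost a m ≡ 0 × boxesAtMost a (m ∸ 1) ≡ 0 × P′ ≡ 0 × Q′ ≡ 0
    beyond m<a = boxesAtMost-zero a m (reflect-≤n i i≥1) m<a
               , boxesAtMost-zero a (m ∸ 1) (ℕₚ.≤-trans (ℕₚ.m∸n≤m m 1) (reflect-≤n i i≥1)) (ℕₚ.≤-<-trans (ℕₚ.m∸n≤m m 1) m<a)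
               , nth-beyond-length (row i) (a ∸ 1) (ℕₚ.≤-trans (ℕₚ.≤-reflexive |P|≡m) (ℕₚ.∸-monoˡ-≤ 1 m<a))
               , Q′-beyond (ℕₚ.<⇒≤ m<a)

module TableauWeight {c ℓ : Level} (R : CommutativeRing c ℓ)
  (n : ℕ) (lam : ℕ → ℕ) (s : State) (adm : Admissible n lam s)
  (T : ℕ → ℕ → ℕ) (ssyt : IsSSYT n lam T) (mp : MatchesPattern n lam s T)
  (z α : ℕ → CommutativeRing.Carrier R) where
  open CommutativeRing R renaming (_+_ to _+R_; _*_ to _*R_; refl to ≈-refl; sym to ≈-sym; trans to ≈-trans)
  open Products R
  open Lattice n lam s adm
  open Thresholds n lam s adm
  open import Relation.Binary.Reasoning.Setoid setoid

  boxFactor : ℕ → ℕ → ℕ → Carrier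
  boxFactor a m c = z m +R α (m + c ∸ a)

  entryBlock : ℕ → ℕ → Carrier
  entryBlock a m = intervalΠ (boxFactor a m) (boxesAtMost a (m ∸ 1)) (boxesAtMost a m)

  latticeBlock : ℕ → ℕ → Carrier
  latticeBlock i = RowTransfer.block R (z (n + 1 ∸ i)) α (row i) (row (suc i))

  module _ (a : ℕ) (a≥1 : 1 ≤ a) (a≤n : a ≤ n) where

    matches : ∀ m → 1 ≤ m → m ≤ n → ∀ c → 1 ≤ c →
        ((a ≤ n + 1 ∸ (n + 1 ∸ m) × c ≤ boxesAtMost a m) → (c ≤ lam a × T a c ≤ n + 1 ∸ (n + 1 ∸ m)))
      × ((c ≤ lam a × T a c ≤ n + 1 ∸ (n + 1 ∸ m)) → (a ≤ n + 1 ∸ (n + 1 ∸ m) × c ≤ boxesAtMost a m))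
    matches m m≥1 m≤n c c≥1 = mp (n + 1 ∸ m) (reflect-≥1 m m≤n) (reflect-≤n m m≥1) a c a≥1 a≤n c≥1

    atMost⇒initial : ∀ m → 1 ≤ m → m ≤ n → ∀ c → 1 ≤ c → c ≤ lam a → T a c ≤ m → c ≤ boxesAtMost a m
    atMost⇒initial m m≥1 m≤n c c≥1 c≤ T≤m =
      proj₂ (proj₂ (matches m m≥1 m≤n c c≥1) (c≤ , ≡.subst (T a c ≤_) (≡.sym (reflect-reflect m m≤n)) T≤m))

    initial⇒atMost : ∀ m → 1 ≤ m → m ≤ n → ∀ c → 1 ≤ c → c ≤ boxesAtMost a m → c ≤ lam a × T a c ≤ m
    initial⇒atMost m m≥1 m≤n c c≥1 c≤b with a ≤? m
    ... | yes a≤m =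
      let box = proj₁ (matches m m≥1 m≤n c c≥1) (≡.subst (a ≤_) (≡.sym (reflect-reflect m m≤n)) a≤m , c≤b)
      in proj₁ box , ≡.subst (T a c ≤_) (reflect-reflect m m≤n) (proj₂ box)
    ... | no a≰m = ⊥-elim (ℕₚ.<-irrefl refl
      (ℕₚ.≤-trans c≥1 (ℕₚ.≤-trans c≤b (ℕₚ.≤-reflexive (boxesAtMost-zero a m m≤n (ℕₚ.≰⇒> a≰m))))))

    row-grouped : Π (lam a) (λ c → boxFactor a (T a c) c) ≈ Π n (entryBlock a)
    row-grouped = GroupByValue.groupByValue (boxFactor a) (T a) (boxesAtMost a) (lam a) n
      (boxesAtMost-zero a 0 z≤n a≥1) (λ c c≥1 c≤ → proj₁ ssyt a c a≥1 a≤n c≥1 c≤)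
      atMost⇒initial initial⇒atMost (ℕₚ.≤-trans a≥1 a≤n)

  block-matches : ∀ i → 1 ≤ i → i ≤ n → ∀ a → 1 ≤ a → entryBlock a (n + 1 ∸ i) ≈ latticeBlock i a
  block-matches i i≥1 i≤n a a≥1 with a ≤? n + 1 ∸ i
  ... | yes a≤m = begin
    entryBlock a m
      ≡⟨ ≡.cong₂ (intervalΠ (boxFactor a m)) (proj₁ (lower-threshold a≤m)) upper-threshold ⟩
    intervalΠ (boxFactor a m) (Q′ ∸ (m ∸ a)) ((P′ ∸ 1) ∸ (m ∸ a))
      ≈⟨ intervalΠ-cong (Q′ ∸ (m ∸ a)) ((P′ ∸ 1) ∸ (m ∸ a)) (λ c → reflexive (≡.cong (λ j → z m +R α j) (ℕₚ.+-∸-comm c a≤m))) ⟩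
    intervalΠ (λ c → yα (m ∸ a + c)) (Q′ ∸ (m ∸ a)) ((P′ ∸ 1) ∸ (m ∸ a))
      ≈⟨ intervalΠ-unshift yα (m ∸ a) Q′ (P′ ∸ 1) (proj₂ (lower-threshold a≤m)) (ℕₚ.∸-monoˡ-≤ 1 (upper-bound a≤m)) ⟩
    intervalΠ yα Q′ (P′ ∸ 1) ∎
    where
    open Reflected i i≥1 i≤n a a≥1
    open RowTransfer R (z m) α using (yα)
  ... | no a≰m with Reflected.beyond i i≥1 i≤n a a≥1 (ℕₚ.≰⇒> a≰m)
  ...   | bm , bm-1 , P′≡0 , Q′≡0
    rewrite bm | bm-1 | P′≡0 | Q′≡0 = ≈-refl

  rho-reflected : rho R n z ≈ Π n (λ i → pow R (z (n + 1 ∸ i)) (n ∸ i))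
  rho-reflected = ≈-trans (Π-reverse n (λ m → pow R (z m) (m ∸ 1)))
    (Π-cong n (λ i _ _ → reflexive (≡.cong (pow R (z (n + 1 ∸ i))) ([n+1∸i]∸1≡n∸i n i))))

  factorialMonomial-blocks : 1 ≤ n → factorialMonomial R n lam z α T ≈ Π n (λ i → Π n (latticeBlock i))
  factorialMonomial-blocks n≥1 = begin
    factorialMonomial R n lam z α T          ≈⟨ Π-cong n row-grouped ⟩
    Π n (λ a → Π n (entryBlock a))           ≈⟨ Π-swap n n entryBlock ⟩
    Π n (λ m → Π n (λ a → entryBlock a m))   ≈⟨ Π-reverse n _ ⟩
    Π n (λ i → Π n (λ a → entryBlock a (n + 1 ∸ i)))
      ≈⟨ Π-cong n (λ i i≥1 i≤n → Π-cong n (λ a a≥1 _ → block-matches i i≥1 i≤n a a≥1)) ⟩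
    Π n (λ i → Π n (latticeBlock i))         ∎

mainTheorem7 : {c ℓ : Level} (R : CommutativeRing c ℓ) →
    (n : ℕ) → 1 ≤ n →
    (lam : ℕ → ℕ) → IsPartition n lam →
    (s : State) → Admissible n lam s →
    (∀ i k → 2 ≤ i → i ≤ k → k ≤ n → pat n lam s (i ∸ 1) (k ∸ 1) > pat n lam s i k) →
    (T : ℕ → ℕ → ℕ) → IsSSYT n lam T → MatchesPattern n lam s T →
    (z α : ℕ → CommutativeRing.Carrier R) →
    CommutativeRing._≈_ R (w0beta R n lam z α s)
      (CommutativeRing._*_ R (rho R n z) (factorialMonomial R n lam z α T))
mainTheorem7 R n n≥1 lam _ s adm strict T ssyt mp z α = begin
  w0beta R n lam z α s
    ≈⟨ Π-cong n (λ i i≥1 i≤n → rowWeight-blocks i i≥1 i≤n (y i) strict) ⟩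
  Π n (λ i → pow R (y i) (n ∸ i) *R Π n (latticeBlock i))
    ≈⟨ Π-* n _ _ ⟩
  Π n (λ i → pow R (y i) (n ∸ i)) *R Π n (λ i → Π n (latticeBlock i))
    ≈⟨ *-cong (≈-sym rho-reflected) (≈-sym (factorialMonomial-blocks n≥1)) ⟩
  rho R n z *R factorialMonomial R n lam z α T ∎
  where
  open CommutativeRing R using (Carrier; setoid; *-cong) renaming (_*_ to _*R_; sym to ≈-sym)
  open import Relation.Binary.Reasoning.Setoid setoid
  open Products R
  open Lattice n lam s adm
  open RowWeight R α
  open TableauWeight R n lam s adm T ssyt mp z α
  y : ℕ → Carrier
  y i = z (n + 1 ∸ i)
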